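{- Let $G=(V,E)$ be a graph and let $u,w\in V$ be distinct. Let $(V_C,E_C)$ be any simple cycle with $V_C\subseteq V$ and $E_C\subseteq\binom{V}{2}$ (not necessarily a cycle of $G$) such that no node $v\in V_C$ is a $uw$-cut-node of $G$ and every edge $e\in E_C$ is a $uw$-separator of $G$. Then the cycle has an even number of edges.
   Context: For distinct $u,w\in V$ and $S\subseteq V$, $S$ is a $uw$-separator of $G$ if every $uw$-path in $G$ contains a node of $S$; an edge $st\in\binom{V}{2}$ is called a $uw$-separator if the set $\{s,t\}$ is. A node $v$ is a $uw$-cut-node of $G$ if $\{v\}$ is a $uw$-separator of $G$. -}

module Defs where

open import Data.Nat using (ℕ; zero; suc)
open import Data.Fin using (Fin; toℕ)
open import Data.Bool using (Bool; true)
open import Data.List using (List; []; _∷_)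
open import Data.List.Relation.Unary.Any using (Any)
open import Data.List.Relation.Unary.Unique.Propositional using (Unique)
open import Data.List.Membership.Propositional using (_∈_)
open import Data.Product using (_×_)
open import Data.Sum using (_⊎_)
open import Relation.Binary.PropositionalEquality using (_≡_)
open import Relation.Nullary using (¬_)

record Graph (n : ℕ) : Set where
  field
    adj   : Fin n → Fin n → Bool
    sym   : ∀ x y → adj x y ≡ adj y x
    irrefl : ∀ x → ¬ (adj x x ≡ true)
open Graph public

data Walk {n : ℕ} (G : Graph n) : Fin n → Fin n → List (Fin n) → Set where
  here : ∀ {v} → Walk G v v (v ∷ [])
  step : ∀ {u v w xs} → adj G u v ≡ true → Walk G v w xs → Walk G u w (u ∷ xs)

IsPath : {n : ℕ} → Graph n → Fin n → Fin n → List (Fin n) → Set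
IsPath G u w xs = Walk G u w xs × Unique xs

IsSeparator : {n : ℕ} → Graph n → Fin n → Fin n → List (Fin n) → Set
IsSeparator G u w S = ∀ xs → IsPath G u w xs → Any (λ x → x ∈ S) xs

IsCutNode : {n : ℕ} → Graph n → Fin n → Fin n → Fin n → Set
IsCutNode G u w v = IsSeparator G u w (v ∷ [])

IsEdgeSeparator : {n : ℕ} → Graph n → Fin n → Fin n → Fin n → Fin n → Set
IsEdgeSeparator G u w s t = IsSeparator G u w (s ∷ t ∷ [])

CycSucc : {k : ℕ} → Fin k → Fin k → Set
CycSucc {k} i j = (suc (toℕ i) ≡ toℕ j) ⊎ (suc (toℕ i) ≡ k × toℕ j ≡ 0)

-- A non-cut node b of the cycle is avoided by some uw-path, which must meet both of its
-- neighbours a and c, because ab and bc are separators; call b forward if such a path can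
-- meet a before c, backward if it can meet c before a. If all nodes are forward (or all backward),
-- the walks witnessing this can be relayed edge by edge around the closed walk until a
-- node is reached from u by a walk avoiding that node itself. Where the orientation
-- switches, at consecutive nodes b and c of a stretch a b c d, the chord ad is again a
-- separator, so b and c can be cut out. Repeating this shrinks an odd closed walk to a
-- single node whose loop is a separator, i.e. to a cut-node.

module Submission where

open import Defs
open import Data.Nat using (ℕ; _≤_)
open import Data.Nat.Divisibility using (_∣_)
open import Data.Fin using (Fin)
open import Function.Definitions using (Injective)
open import Relation.Binary.PropositionalEquality using (_≡_)
open import Relation.Nullary using (¬_)

open import Data.Bool using (true)
open import Data.Empty using (⊥; ⊥-elim)
open import Data.Fin using (toℕ; _≟_)
open import Data.Fin.Properties using (toℕ-fromℕ<; fromℕ<-cong)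
open import Data.List using (List; []; _∷_; _++_; drop)
open import Data.List.Membership.Propositional using (_∈_; _∉_; find)
open import Data.List.Relation.Binary.Subset.Propositional using (_⊆_)
open import Data.List.Relation.Binary.Subset.Propositional.Properties using (⊆-refl; ∷⁺ʳ; ∈-∷⁺ʳ)
open import Data.List.Relation.Unary.All as All using (All; []; _∷_)
open import Data.List.Relation.Unary.All.Properties using (¬Any⇒All¬; All¬⇒¬Any; anti-mono; ++⁺; drop⁺)
open import Data.List.Relation.Unary.AllPairs using ([]; _∷_)
open import Data.List.Relation.Unary.Any as Any using (here; there; any?)
open import Data.Nat using (zero; suc; _+_; _*_; _%_; _/_)
open import Data.Nat.Divisibility using (divides; _∣0)
open import Data.Nat.DivMod using (_mod_; m≡m%n+[m/n]*n; [m+kn]%n≡m%n; [m+n]%n≡m%n; m<n⇒m%n≡m; n%n≡0; m%n<n)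
open import Data.Nat.Properties using (+-commutativeSemigroup; +-comm; suc-injective; m≤n⇒m<n∨m≡n)
open import Algebra.Properties.CommutativeSemigroup +-commutativeSemigroup using (xy∙z≈xz∙y)
open import Data.Product using (∃; _×_; _,_; proj₁; proj₂)
open import Data.Product as Product using ()
open import Data.Sum using (_⊎_; inj₁; inj₂; [_,_])
open import Data.Sum as Sum using ()
open import Function using (_∘_)
open import Relation.Binary.PropositionalEquality using (_≢_; refl; trans; cong; subst; subst₂; module ≡-Reasoning)
import Relation.Binary.PropositionalEquality as ≡
open import Relation.Nullary using (yes; no)

private
  variable
    n k : ℕ
    a b c d s t v x y : Fin n
    S T xs : List (Fin n)

[1+m]%n≡[1+m%n]%n : ∀ m K → suc m % suc K ≡ suc (m % suc K) % suc K
[1+m]%n≡[1+m%n]%n m K = trans (cong (λ r → suc r % suc K) (m≡m%n+[m/n]*n m (suc K)))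
                              ([m+kn]%n≡m%n (suc (m % suc K)) (m / suc K) (suc K))

suc-%-cases : ∀ m K → suc m % suc K ≡ suc (m % suc K) ⊎ (m % suc K ≡ K × suc m % suc K ≡ 0)
suc-%-cases m K with m≤n⇒m<n∨m≡n (m%n<n m (suc K))
... | inj₁ lt = inj₁ (trans ([1+m]%n≡[1+m%n]%n m K) (m<n⇒m%n≡m lt))
... | inj₂ eq = inj₂ (suc-injective eq , trans ([1+m]%n≡[1+m%n]%n m K) (trans (cong (_% suc K) eq) (n%n≡0 (suc K))))

even-or-odd : ∀ k → 2 ∣ k ⊎ ∃ λ m → k ≡ suc (m * 2)
even-or-odd zero = inj₁ (2 ∣0)
even-or-odd (suc zero) = inj₂ (0 , refl)
even-or-odd (suc (suc k)) with even-or-odd k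
... | inj₁ (divides q eq) = inj₁ (divides (suc q) (cong (2 +_) eq))
... | inj₂ (m , eq) = inj₂ (suc m , cong (2 +_) eq)

¬¬-chase : {O R : ℕ → Set} → (∀ j → O j → ¬ ¬ O (suc j)) → (∀ j → O (suc j) → R j → R (suc j)) →
           O 0 → R 0 → ∀ m → ¬ ¬ R m
¬¬-chase {O} {R} persist advance o₀ r₀ m ¬r = relay m (¬r ∘ proj₂)
  where
  relay : ∀ m → ¬ ¬ (O m × R m)
  relay zero ¬or = ¬or (o₀ , r₀)
  relay (suc m) ¬or = relay m λ (o , r) → persist m o λ o′ → ¬or (o′ , advance m o′ r)

pair⊆ : {A : Set} {p q : A} {S : List A} → p ∈ S → q ∈ S → p ∷ q ∷ [] ⊆ S
pair⊆ p∈ q∈ = ∈-∷⁺ʳ p∈ (∈-∷⁺ʳ q∈ λ ())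

swap⊆ : {A : Set} {p q : A} → p ∷ q ∷ [] ⊆ q ∷ p ∷ []
swap⊆ = pair⊆ (there (here refl)) (here refl)

∉-∷ : {A : Set} {p q : A} {S : List A} → p ≢ q → p ∉ S → p ∉ q ∷ S
∉-∷ p≢q _ (here p≡q) = p≢q p≡q
∉-∷ _ p∉S (there p∈S) = p∉S p∈S

module _ {G : Graph n} where

  open import Data.List.Membership.DecPropositional (_≟_ {n}) using (_∈?_)

  walk-target : Walk G a b xs → b ∈ xs
  walk-target here = here refl
  walk-target (step _ W) = there (walk-target W)

  walk-append : ∀ {ys} → Walk G a b xs → Walk G b c ys → Walk G a c (xs ++ drop 1 ys)
  walk-append here here = here
  walk-append here (step e W) = step e W
  walk-append (step e W₁) W₂ = step e (walk-append W₁ W₂)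

  walk-to : Walk G a b xs → y ∈ xs → ∃ λ zs → Walk G a y zs × zs ⊆ xs
  walk-to here (here refl) = _ , here , ⊆-refl
  walk-to (step _ _) (here refl) = _ , here , ∷⁺ʳ _ λ ()
  walk-to (step e W) (there y∈) with walk-to W y∈
  ... | zs , W′ , zs⊆ = _ , step e W′ , ∷⁺ʳ _ zs⊆

  path-from : IsPath G a b xs → y ∈ xs → ∃ λ zs → IsPath G y b zs × zs ⊆ xs
  path-from P@(here , _) (here refl) = _ , P , ⊆-refl
  path-from P@(step _ _ , _) (here refl) = _ , P , ⊆-refl
  path-from (step _ W , _ ∷ U) (there y∈) with path-from (W , U) y∈
  ... | zs , P , zs⊆ = zs , P , there ∘ zs⊆

  walk⇒path : Walk G a b xs → ∃ λ ys → IsPath G a b ys × ys ⊆ xs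
  walk⇒path here = _ , (here , [] ∷ []) , ⊆-refl
  walk⇒path {a = a} (step e W) with walk⇒path W
  ... | ys , (W′ , U) , ys⊆ with a ∈? ys
  ...   | no a∉ = a ∷ ys , (step e W′ , ¬Any⇒All¬ ys a∉ ∷ U) , ∷⁺ʳ a ys⊆
  ...   | yes a∈ with path-from (W′ , U) a∈
  ...     | zs , P , zs⊆ = zs , P , there ∘ ys⊆ ∘ zs⊆

Avoiding : Graph n → List (Fin n) → Fin n → Fin n → Set
Avoiding G S a b = ∃ λ xs → Walk G a b xs × All (_∉ S) xs

-- The two halves of an s-t path avoiding S that meets x before y.
Precedes : Graph n → List (Fin n) → Fin n → Fin n → Fin n → Fin n → Set
Precedes G S s t x y = Avoiding G (y ∷ S) s x × Avoiding G (x ∷ S) y t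

module _ {G : Graph n} where

  open import Data.List.Membership.DecPropositional (_≟_ {n}) using (_∈?_)

  Avoiding-⊆ : T ⊆ S → Avoiding G S a b → Avoiding G T a b
  Avoiding-⊆ T⊆S (xs , W , A) = xs , W , All.map (_∘ T⊆S) A

  Avoiding-step : adj G a b ≡ true → a ∉ S → Avoiding G S b c → Avoiding G S a c
  Avoiding-step e a∉ (xs , W , A) = _ , step e W , a∉ ∷ A

  Avoiding-trans : Avoiding G S a b → Avoiding G S b c → Avoiding G S a c
  Avoiding-trans (_ , W₁ , A₁) (_ , W₂ , A₂) = _ , walk-append W₁ W₂ , ++⁺ A₁ (drop⁺ 1 A₂)

  Avoiding-source : Avoiding G S a b → a ∉ S
  Avoiding-source (_ , here , a∉ ∷ _) = a∉
  Avoiding-source (_ , step _ _ , a∉ ∷ _) = a∉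

  Avoiding-target : Avoiding G S a b → b ∉ S
  Avoiding-target (_ , W , A) = All.lookup A (walk-target W)

  Avoiding-∷ : (Avoiding G S a c → Avoiding G S c b → ⊥) → Avoiding G S a b → Avoiding G (c ∷ S) a b
  Avoiding-∷ {c = c} no-split (xs , W , A) with walk⇒path W
  ... | ys , P , ys⊆ with c ∈? ys | anti-mono ys⊆ A
  ...   | no c∉ | A′ = ys , proj₁ P , All.tabulate λ z∈ → ∉-∷ (λ { refl → c∉ z∈ }) (All.lookup A′ z∈)
  ...   | yes c∈ | A′ with walk-to (proj₁ P) c∈ | path-from P c∈
  ...     | _ , W₁ , ⊆₁ | _ , (W₂ , _) , ⊆₂ = ⊥-elim (no-split (_ , W₁ , anti-mono ⊆₁ A′) (_ , W₂ , anti-mono ⊆₂ A′))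

  source-precedes : IsPath G s t (s ∷ xs) → All (_∉ S) (s ∷ xs) → y ∈ xs → Precedes G S s t s y
  source-precedes (step _ W , s∉ ∷ U) (s∉S ∷ A) y∈ with path-from (W , U) y∈
  ... | zs , (W′ , _) , zs⊆ =
    (_ , here , ∉-∷ (All.lookup s∉ y∈) s∉S ∷ []) ,
    (zs , W′ , All.tabulate λ z∈ → ∉-∷ (λ z≡s → All.lookup s∉ (zs⊆ z∈) (≡.sym z≡s)) (All.lookup A (zs⊆ z∈)))

  path-order : IsPath G s t xs → All (_∉ S) xs → x ∈ xs → y ∈ xs → x ≢ y →
               Precedes G S s t x y ⊎ Precedes G S s t y x
  path-order (here , _) _ (here refl) (here refl) x≢y = ⊥-elim (x≢y refl)
  path-order (step _ _ , _) _ (here refl) (here refl) x≢y = ⊥-elim (x≢y refl)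
  path-order P@(step _ _ , _) A (here refl) (there y∈) _ = inj₁ (source-precedes P A y∈)
  path-order P@(step _ _ , _) A (there x∈) (here refl) _ = inj₂ (source-precedes P A x∈)
  path-order (step e W , s∉ ∷ U) (s∉S ∷ A) (there x∈) (there y∈) x≢y =
    Sum.map (Product.map₁ (Avoiding-step e (∉-∷ (All.lookup s∉ y∈) s∉S)))
            (Product.map₁ (Avoiding-step e (∉-∷ (All.lookup s∉ x∈) s∉S)))
            (path-order (W , U) A x∈ y∈ x≢y)

module Separators {n : ℕ} (G : Graph n) (u w : Fin n) where

  open import Data.List.Membership.DecPropositional (_≟_ {n}) using (_∈?_)

  separator-mono : S ⊆ T → IsSeparator G u w S → IsSeparator G u w T
  separator-mono S⊆T sep xs P = Any.map S⊆T (sep xs P)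

  separator-intro : (∀ xs → IsPath G u w xs → All (_∉ S) xs → ⊥) → IsSeparator G u w S
  separator-intro {S = S} no-avoiding xs P with any? (_∈? S) xs
  ... | yes hit = hit
  ... | no miss = ⊥-elim (no-avoiding xs P (¬Any⇒All¬ xs miss))

  separator-blocks : IsSeparator G u w S → Avoiding G S u v → Avoiding G S v w → ⊥
  separator-blocks sep u⇝v v⇝w with Avoiding-trans u⇝v v⇝w
  ... | _ , W , A with walk⇒path W
  ... | ys , P , ys⊆ = All¬⇒¬Any (anti-mono ys⊆ A) (sep ys P)

  edge-separator-sym : IsEdgeSeparator G u w a b → IsEdgeSeparator G u w b a
  edge-separator-sym = separator-mono swap⊆

  loop-separator⇒cut-node : IsEdgeSeparator G u w a a → IsCutNode G u w a
  loop-separator⇒cut-node = separator-mono (pair⊆ (here refl) (here refl))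

  separator-other-end : IsEdgeSeparator G u w a b → IsPath G u w xs → All (_∉ T) xs → a ∈ T → b ∈ xs
  separator-other-end sep P A a∈T with find (sep _ P)
  ... | _ , z∈ , here refl = ⊥-elim (All.lookup A z∈ a∈T)
  ... | _ , z∈ , there (here refl) = z∈

  Before : Fin n → Fin n → Fin n → Set
  Before a b c = Precedes G (b ∷ []) u w a c

  orientation : IsEdgeSeparator G u w a b → IsEdgeSeparator G u w b c → ¬ IsCutNode G u w b → a ≢ c →
                ¬ ¬ (Before a b c ⊎ Before c b a)
  orientation ab bc b-not-cut a≢c unordered = b-not-cut (separator-intro λ xs P avoids-b →
    unordered (path-order P avoids-b (separator-other-end (edge-separator-sym ab) P avoids-b (here refl))
                                      (separator-other-end bc P avoids-b (here refl)) a≢c))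

  relay-from-u : IsEdgeSeparator G u w a b → Before a b c →
                 Avoiding G (a ∷ b ∷ []) u v → Avoiding G (b ∷ c ∷ []) u v
  relay-from-u ab (_ , c⇝w) u⇝v =
    Avoiding-⊆ (pair⊆ (there (there (here refl))) (here refl))
               (Avoiding-∷ (λ u⇝c _ → separator-blocks ab u⇝c c⇝w) u⇝v)

  relay-to-w : IsEdgeSeparator G u w a b → Before c b a →
               Avoiding G (a ∷ b ∷ []) v w → Avoiding G (b ∷ c ∷ []) v w
  relay-to-w ab (u⇝c , _) v⇝w =
    Avoiding-⊆ (pair⊆ (there (there (here refl))) (here refl))
               (Avoiding-∷ (λ _ c⇝w → separator-blocks ab u⇝c c⇝w) v⇝w)

  chord-by-order : IsEdgeSeparator G u w a b → IsEdgeSeparator G u w c d → b ≢ c →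
                   (Avoiding G (c ∷ d ∷ []) u b → Avoiding G (a ∷ b ∷ []) c w → ⊥) →
                   (Avoiding G (a ∷ b ∷ []) u c → Avoiding G (c ∷ d ∷ []) b w → ⊥) →
                   IsEdgeSeparator G u w a d
  chord-by-order ab cd b≢c b-first-impossible c-first-impossible = separator-intro λ xs P avoids-ad →
    [ (λ (u⇝b , c⇝w) → b-first-impossible (Avoiding-⊆ cd⊆cad u⇝b) (Avoiding-⊆ ab⊆bad c⇝w))
    , (λ (u⇝c , b⇝w) → c-first-impossible (Avoiding-⊆ ab⊆bad u⇝c) (Avoiding-⊆ cd⊆cad b⇝w))
    ] (path-order P avoids-ad (separator-other-end ab P avoids-ad (here refl))
                              (separator-other-end (edge-separator-sym cd) P avoids-ad (there (here refl))) b≢c)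
    where
    ab⊆bad : a ∷ b ∷ [] ⊆ b ∷ a ∷ d ∷ []
    ab⊆bad = pair⊆ (there (here refl)) (here refl)

    cd⊆cad : c ∷ d ∷ [] ⊆ c ∷ a ∷ d ∷ []
    cd⊆cad = pair⊆ (here refl) (there (there (here refl)))

  chord-from-targets : IsEdgeSeparator G u w a b → IsEdgeSeparator G u w c d → b ≢ c →
                       Avoiding G (a ∷ b ∷ []) c w → Avoiding G (d ∷ c ∷ []) b w → IsEdgeSeparator G u w a d
  chord-from-targets ab cd b≢c c⇝w b⇝w = chord-by-order ab cd b≢c
    (λ u⇝b _ → separator-blocks cd u⇝b (Avoiding-⊆ swap⊆ b⇝w))
    (λ u⇝c _ → separator-blocks ab u⇝c c⇝w)

  chord-from-sources : IsEdgeSeparator G u w a b → IsEdgeSeparator G u w c d → b ≢ c →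
                       Avoiding G (a ∷ b ∷ []) u c → Avoiding G (d ∷ c ∷ []) u b → IsEdgeSeparator G u w a d
  chord-from-sources ab cd b≢c u⇝c u⇝b = chord-by-order ab cd b≢c
    (λ _ c⇝w → separator-blocks ab u⇝c c⇝w)
    (λ _ b⇝w → separator-blocks cd (Avoiding-⊆ swap⊆ u⇝b) b⇝w)

  record SeparatingClosedWalk (k : ℕ) (x : ℕ → Fin n) : Set where
    field
      periodic : ∀ a → x (a + k) ≡ x a
      not-cut : ∀ a → ¬ IsCutNode G u w (x a)
      separating : ∀ a → IsEdgeSeparator G u w (x a) (x (suc a))

  shift : ∀ {x} → SeparatingClosedWalk k x → ∀ j → SeparatingClosedWalk k (λ a → x (a + j))
  shift {k} {x} W j = record
    { periodic = λ a → trans (cong x (xy∙z≈xz∙y a k j)) (periodic (a + j))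
    ; not-cut = λ a → not-cut (a + j)
    ; separating = λ a → separating (a + j)
    }
    where open SeparatingClosedWalk W

  shortcut : ∀ {K x} → SeparatingClosedWalk (3 + K) x → IsEdgeSeparator G u w (x 0) (x 3) →
             SeparatingClosedWalk (suc K) (λ t → x (t % suc K + 3))
  shortcut {K} {x} W chord = record
    { periodic = λ t → cong (λ r → x (r + 3)) ([m+n]%n≡m%n t (suc K))
    ; not-cut = λ t → not-cut (t % suc K + 3)
    ; separating = separating′
    }
    where
    open SeparatingClosedWalk W

    separating′ : ∀ t → IsEdgeSeparator G u w (x (t % suc K + 3)) (x (suc t % suc K + 3))
    separating′ t with suc-%-cases t K
    ... | inj₁ eq = subst (λ r → IsEdgeSeparator G u w (x (t % suc K + 3)) (x (r + 3))) (≡.sym eq)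
                          (separating (t % suc K + 3))
    ... | inj₂ (last , wraps) = subst₂ (IsEdgeSeparator G u w) (≡.sym closes) (cong (λ r → x (r + 3)) (≡.sym wraps)) chord
      where
      open ≡-Reasoning
      closes : x (t % suc K + 3) ≡ x 0
      closes = begin
        x (t % suc K + 3) ≡⟨ cong (λ r → x (r + 3)) last ⟩
        x (K + 3)         ≡⟨ cong x (+-comm K 3) ⟩
        x (3 + K)         ≡⟨ periodic 0 ⟩
        x 0               ∎

  separating-chord : ∀ {K x} → SeparatingClosedWalk (suc K) x →
                     ¬ (∀ j → ¬ IsEdgeSeparator G u w (x j) (x (3 + j)))
  separating-chord {K} {x} W no-chord = orientation-at 0 [ forward-impossible , backward-impossible ]
    where
    open SeparatingClosedWalk W

    edge : ℕ → List (Fin n)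
    edge j = x j ∷ x (suc j) ∷ []

    Forward Backward : ℕ → Set
    Forward j = Before (x j) (x (1 + j)) (x (2 + j))
    Backward j = Before (x (2 + j)) (x (1 + j)) (x j)

    adjacent-distinct : ∀ j → x j ≢ x (suc j)
    adjacent-distinct j eq =
      not-cut j (loop-separator⇒cut-node (subst (IsEdgeSeparator G u w (x j)) (≡.sym eq) (separating j)))

    skip-distinct : ∀ j → x (1 + j) ≢ x (3 + j)
    skip-distinct j eq = no-chord j (subst (IsEdgeSeparator G u w (x j)) eq (separating j))

    -- At j = 0, periodicity turns x 0 and x 2 into x (1 + K) and x (3 + K).
    distinct : ∀ j → x j ≢ x (2 + j)
    distinct zero eq = skip-distinct K (trans (periodic 0) (trans eq (≡.sym (periodic 2))))
    distinct (suc j) = skip-distinct j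

    orientation-at : ∀ j → ¬ ¬ (Forward j ⊎ Backward j)
    orientation-at j = orientation (separating j) (separating (1 + j)) (not-cut (1 + j)) (distinct j)

    forward-persists : ∀ j → Forward j → ¬ ¬ Forward (suc j)
    forward-persists j f ¬f′ = orientation-at (suc j)
      [ ¬f′
      , (λ b → no-chord j (chord-from-targets (separating j) (separating (2 + j)) (adjacent-distinct (1 + j))
                                               (proj₂ f) (proj₂ b)))
      ]

    backward-persists : ∀ j → Backward j → ¬ ¬ Backward (suc j)
    backward-persists j b ¬b′ = orientation-at (suc j)
      [ (λ f → no-chord j (chord-from-sources (separating j) (separating (2 + j)) (adjacent-distinct (1 + j))
                                               (proj₁ b) (proj₁ f)))
      , ¬b′
      ]

    forward-impossible : ¬ Forward 0
    forward-impossible f₀ =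
      ¬¬-chase {R = λ j → Avoiding G (edge (suc j)) u (x 0)} forward-persists (λ j → relay-from-u (separating (suc j)))
               f₀ (Avoiding-⊆ swap⊆ (proj₁ f₀)) K (λ u⇝x₀ → Avoiding-target u⇝x₀ (here (≡.sym (periodic 0))))

    backward-impossible : ¬ Backward 0
    backward-impossible b₀ =
      ¬¬-chase {R = λ j → Avoiding G (edge (suc j)) (x 0) w} backward-persists (λ j → relay-to-w (separating (suc j)))
               b₀ (Avoiding-⊆ swap⊆ (proj₂ b₀)) K (λ x₀⇝w → Avoiding-source x₀⇝w (here (≡.sym (periodic 0))))

  odd-period-impossible : ∀ m {x} → ¬ SeparatingClosedWalk (suc (m * 2)) x
  odd-period-impossible zero {x} W =
    not-cut 0 (loop-separator⇒cut-node (subst (IsEdgeSeparator G u w (x 0)) (periodic 0) (separating 0)))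
    where open SeparatingClosedWalk W
  odd-period-impossible (suc m) W =
    separating-chord W λ j chord → odd-period-impossible m (shortcut (shift W j) chord)

  separating-closed-walk-even : ∀ {x} → SeparatingClosedWalk k x → 2 ∣ k
  separating-closed-walk-even {k} W with even-or-odd k
  ... | inj₁ 2∣k = 2∣k
  ... | inj₂ (m , refl) = ⊥-elim (odd-period-impossible m W)

  cycle⇒closed-walk : ∀ {K} (c : Fin (suc K) → Fin n) → (∀ i → ¬ IsCutNode G u w (c i)) →
                      (∀ i j → CycSucc i j → IsEdgeSeparator G u w (c i) (c j)) →
                      SeparatingClosedWalk (suc K) (λ a → c (a mod suc K))
  cycle⇒closed-walk {K} c not-cut′ separating′ = record
    { periodic = λ a → cong c (fromℕ<-cong _ _ ([m+n]%n≡m%n a (suc K)) _ _)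
    ; not-cut = λ a → not-cut′ (a mod suc K)
    ; separating = λ a → separating′ _ _ (successive a)
    }
    where
    toℕ-mod : ∀ a → toℕ (a mod suc K) ≡ a % suc K
    toℕ-mod a = toℕ-fromℕ< (m%n<n a (suc K))

    successive : ∀ a → CycSucc (a mod suc K) (suc a mod suc K)
    successive a with suc-%-cases a K
    ... | inj₁ eq = inj₁ (trans (cong suc (toℕ-mod a)) (trans (≡.sym eq) (≡.sym (toℕ-mod (suc a)))))
    ... | inj₂ (last , wraps) = inj₂ (cong suc (trans (toℕ-mod a) last) , trans (toℕ-mod (suc a)) wraps)

lemma2 : {n : ℕ} (G : Graph n) (u w : Fin n) → ¬ (u ≡ w) →
    (k : ℕ) → 3 ≤ k → (c : Fin k → Fin n) → Injective _≡_ _≡_ c →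
    (∀ i → ¬ IsCutNode G u w (c i)) →
    (∀ i j → CycSucc i j → IsEdgeSeparator G u w (c i) (c j)) →
    2 ∣ k
lemma2 G u w _ zero _ _ _ _ _ = 2 ∣0
lemma2 G u w _ (suc K) _ c _ not-cut separating =
  separating-closed-walk-even (cycle⇒closed-walk c not-cut separating)
  where open Separators G u w
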